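{- Let the free group $\mathbb F_2$ on generators $\sigma,\tau$ act on a set $\Omega$ so that every stabiliser $\mathrm{Stab}(z)=\{\gamma\in\mathbb F_2:\gamma\cdot z=z\}$ ($z\in\Omega$) is abelian. Let $\mathcal O$ be an orbit of this action whose elements have nontrivial stabilisers, let $\omega\ne\varepsilon$ be a reduced word of minimal length among the non-identity elements of $\mathbb F_2$ fixing at least one element of $\mathcal O$, let $x\in\mathcal O$ with $\omega\cdot x=x$, and let $\alpha\in\{\sigma^{\pm1},\tau^{\pm1}\}$ be the first letter of $\omega$. Then for each $y\in\mathcal O$ there is a unique reduced word $\zeta\in\mathbb F_2$ that ends neither in $\alpha^{ -1}$ nor in $\omega$ and such that $y=\zeta\cdot x$.
   Context: Elements of $\mathbb F_2$ are identified with reduced words; a reduced word $\zeta$ "ends in" a reduced word $\beta$ if $\zeta=\zeta'\beta$ with the concatenation $\zeta'\beta$ already reduced. $\varepsilon$ is the empty word. -}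

module Defs where

open import Level using (Level; _⊔_; suc)
open import Data.List using (List; []; _∷_; _++_; foldr; length)
open import Data.Product using (Σ; ∃; _×_; _,_)
open import Data.Empty using (⊥)
open import Data.Unit using (⊤)
open import Data.Nat using (_≤_)
open import Relation.Nullary using (¬_)
open import Relation.Binary.PropositionalEquality using (_≡_)

data Letter : Set where
  σ σ⁻¹ τ τ⁻¹ : Letter

inv : Letter → Letter
inv σ = σ⁻¹
inv σ⁻¹ = σ
inv τ = τ⁻¹
inv τ⁻¹ = τ

Word : Set
Word = List Letter

ε : Word
ε = []

Reduced : Word → Set
Reduced [] = ⊤
Reduced (a ∷ []) = ⊤
Reduced (a ∷ b ∷ w) = ¬ (b ≡ inv a) × Reduced (b ∷ w)

cancels : Letter → Letter → Set
cancels a b = b ≡ inv a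

_◁_ : Letter → Word → Word
σ ◁ (σ⁻¹ ∷ w) = w
σ⁻¹ ◁ (σ ∷ w) = w
τ ◁ (τ⁻¹ ∷ w) = w
τ⁻¹ ◁ (τ ∷ w) = w
a ◁ w = a ∷ w

-- Group multiplication on reduced words: reduced form of the concatenation.
_·_ : Word → Word → Word
u · v = foldr _◁_ v u

_⁻¹ : Word → Word
[] ⁻¹ = []
(a ∷ w) ⁻¹ = w ⁻¹ ++ (inv a ∷ [])

record Action {ℓ : Level} (Ω : Set ℓ) : Set ℓ where
  field
    act     : Word → Ω → Ω
    act-ε   : ∀ z → act ε z ≡ z
    act-mul : ∀ u v → Reduced u → Reduced v → ∀ z →
              act (u · v) z ≡ act u (act v z)

module _ {ℓ : Level} {Ω : Set ℓ} (A : Action Ω) where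
  open Action A

  Fixes : Word → Ω → Set ℓ
  Fixes γ z = Reduced γ × act γ z ≡ z

  AbelianStabilisers : Set ℓ
  AbelianStabilisers = ∀ z γ δ → Fixes γ z → Fixes δ z → γ · δ ≡ δ · γ

  InOrbit : Ω → Ω → Set ℓ
  InOrbit x y = Σ Word λ γ → Reduced γ × act γ x ≡ y

EndsIn : Word → Word → Set
EndsIn ζ β = Σ Word λ ζ' → Reduced (ζ' ++ β) × ζ ≡ ζ' ++ β

-- Call a reduced word normal if it ends neither in α⁻¹ nor in ω, and write ω = α ω′.
-- Because ω fixes x, multiplying a normal word on the left by a letter b can be
-- renormalised without changing its image ζ·x: cancel b against a leading b⁻¹,
-- replace the word by ε when it becomes ω, and replace the single letter α⁻¹ by ω′
-- (which is normal, as minimality forces ω to be cyclically reduced). Induction on a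
-- word reaching y gives a normal word reaching y. This renormalised multiplication is
-- invertible, so peeling off letters reduces uniqueness to the claim that a normal word
-- ζ fixing x is trivial. Such ζ commutes with ω in the abelian stabiliser of x. As ζ
-- does not end in α⁻¹, nothing cancels in ζω, hence by length nothing cancels in ωζ,
-- and ζω = ωζ letter by letter. Minimality gives |ω| ≤ |ζ|, so ζ ends in ω.
module Submission where

open import Defs
open import Level using (Level)
open import Function using (_∘_)
open import Data.List using (List; []; _∷_; length; _++_)
open import Data.List.Properties
  using (∷-injectiveˡ; ∷-injectiveʳ; ≡-dec; length-++-comm; length-++-≤ˡ; length-++-≤ʳ; ++-assoc; ++-cancelˡ)
open import Data.Product using (Σ; _×_; _,_; proj₁)
open import Data.Sum using (_⊎_; inj₁; inj₂)
open import Data.Nat using (_≤_; _<_; s≤s)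
open import Data.Nat.Properties using (≤-refl; <⇒≢; ≤⇒≯; 1+n≰n; <-trans; m<n⇒m<1+n)
open import Data.Empty using (⊥-elim)
open import Data.Unit using (tt)
open import Relation.Nullary using (¬_; yes; no; contradiction)
open import Relation.Binary.Definitions using (DecidableEquality)
open import Relation.Binary.PropositionalEquality
  using (_≡_; _≢_; refl; sym; trans; cong; subst; module ≡-Reasoning)

open ≡-Reasoning

inv-involutive : ∀ a → inv (inv a) ≡ a
inv-involutive σ = refl
inv-involutive σ⁻¹ = refl
inv-involutive τ = refl
inv-involutive τ⁻¹ = refl

a≢inv-a : ∀ a → a ≢ inv a
a≢inv-a σ ()
a≢inv-a σ⁻¹ ()
a≢inv-a τ ()
a≢inv-a τ⁻¹ ()

_≟_ : DecidableEquality Letter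
σ ≟ σ = yes refl
σ ≟ σ⁻¹ = no λ ()
σ ≟ τ = no λ ()
σ ≟ τ⁻¹ = no λ ()
σ⁻¹ ≟ σ = no λ ()
σ⁻¹ ≟ σ⁻¹ = yes refl
σ⁻¹ ≟ τ = no λ ()
σ⁻¹ ≟ τ⁻¹ = no λ ()
τ ≟ σ = no λ ()
τ ≟ σ⁻¹ = no λ ()
τ ≟ τ = yes refl
τ ≟ τ⁻¹ = no λ ()
τ⁻¹ ≟ σ = no λ ()
τ⁻¹ ≟ σ⁻¹ = no λ ()
τ⁻¹ ≟ τ = no λ ()
τ⁻¹ ≟ τ⁻¹ = yes refl

◁-cancel : ∀ a w → a ◁ (inv a ∷ w) ≡ w
◁-cancel σ w = refl
◁-cancel σ⁻¹ w = refl
◁-cancel τ w = refl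
◁-cancel τ⁻¹ w = refl

inv-◁-cancel : ∀ a w → inv a ◁ (a ∷ w) ≡ w
inv-◁-cancel a w = subst (λ b → inv a ◁ (b ∷ w) ≡ w) (inv-involutive a) (◁-cancel (inv a) w)

◁-view : ∀ a w → a ◁ w ≡ a ∷ w ⊎ w ≡ inv a ∷ (a ◁ w)
◁-view σ [] = inj₁ refl
◁-view σ (σ ∷ w) = inj₁ refl
◁-view σ (σ⁻¹ ∷ w) = inj₂ refl
◁-view σ (τ ∷ w) = inj₁ refl
◁-view σ (τ⁻¹ ∷ w) = inj₁ refl
◁-view σ⁻¹ [] = inj₁ refl
◁-view σ⁻¹ (σ ∷ w) = inj₂ refl
◁-view σ⁻¹ (σ⁻¹ ∷ w) = inj₁ refl
◁-view σ⁻¹ (τ ∷ w) = inj₁ refl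
◁-view σ⁻¹ (τ⁻¹ ∷ w) = inj₁ refl
◁-view τ [] = inj₁ refl
◁-view τ (σ ∷ w) = inj₁ refl
◁-view τ (σ⁻¹ ∷ w) = inj₁ refl
◁-view τ (τ ∷ w) = inj₁ refl
◁-view τ (τ⁻¹ ∷ w) = inj₂ refl
◁-view τ⁻¹ [] = inj₁ refl
◁-view τ⁻¹ (σ ∷ w) = inj₁ refl
◁-view τ⁻¹ (σ⁻¹ ∷ w) = inj₁ refl
◁-view τ⁻¹ (τ ∷ w) = inj₂ refl
◁-view τ⁻¹ (τ⁻¹ ∷ w) = inj₁ refl

◁-reduced : ∀ a w → Reduced (a ∷ w) → a ◁ w ≡ a ∷ w
◁-reduced a w r with ◁-view a w
... | inj₁ e = e
... | inj₂ e = ⊥-elim (proj₁ (subst (λ v → Reduced (a ∷ v)) e r) refl)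

Reduced-tail : ∀ a w → Reduced (a ∷ w) → Reduced w
Reduced-tail a [] _ = tt
Reduced-tail a (b ∷ w) (_ , r) = r

Reduced-++ˡ : ∀ u v → Reduced (u ++ v) → Reduced u
Reduced-++ˡ [] v _ = tt
Reduced-++ˡ (a ∷ []) v _ = tt
Reduced-++ˡ (a ∷ b ∷ u) v (h , r) = h , Reduced-++ˡ (b ∷ u) v r

Reduced-++ʳ : ∀ u v → Reduced (u ++ v) → Reduced v
Reduced-++ʳ [] v r = r
Reduced-++ʳ (a ∷ u) v r = Reduced-++ʳ u v (Reduced-tail a (u ++ v) r)

¬EndsIn-[] : ∀ c β → ¬ EndsIn [] (c ∷ β)
¬EndsIn-[] c β ([] , _ , ())
¬EndsIn-[] c β (_ ∷ _ , _ , ())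

EndsIn-∷ : ∀ a ξ β → Reduced (a ∷ ξ) → EndsIn ξ β → EndsIn (a ∷ ξ) β
EndsIn-∷ a ξ β r (s , _ , e) = a ∷ s , subst (λ w → Reduced (a ∷ w)) e r , cong (a ∷_) e

¬EndsIn-∷ : ∀ b ξ β → b ∷ ξ ≢ β → ¬ EndsIn ξ β → ¬ EndsIn (b ∷ ξ) β
¬EndsIn-∷ b ξ β b∷ξ≢β _ ([] , _ , e) = b∷ξ≢β e
¬EndsIn-∷ b ξ β _ ¬ξβ (c ∷ s , r , e) = ¬ξβ (s , Reduced-tail c (s ++ β) r , ∷-injectiveʳ e)

EndsIn-length : ∀ ζ β → EndsIn ζ β → length β ≤ length ζ
EndsIn-length _ β (s , _ , refl) = length-++-≤ʳ β {s}

Reduced-++ : ∀ u b v → Reduced u → Reduced (b ∷ v) → ¬ EndsIn u (inv b ∷ []) → Reduced (u ++ b ∷ v)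
Reduced-++ [] b v _ rbv _ = rbv
Reduced-++ (a ∷ []) b v _ rbv ¬ends = b≢inv-a , rbv
  where
  b≢inv-a : b ≢ inv a
  b≢inv-a e = ¬ends ([] , tt , cong (_∷ []) (sym (trans (cong inv e) (inv-involutive a))))
Reduced-++ (a ∷ c ∷ u) b v (h , r) rbv ¬ends =
  h , Reduced-++ (c ∷ u) b v r rbv (¬ends ∘ EndsIn-∷ a (c ∷ u) _ (h , r))

·-++ : ∀ u v → Reduced (u ++ v) → u · v ≡ u ++ v
·-++ [] v r = refl
·-++ (a ∷ u) v r = begin
  a ◁ (u · v)   ≡⟨ cong (a ◁_) (·-++ u v (Reduced-tail a (u ++ v) r)) ⟩
  a ◁ (u ++ v)  ≡⟨ ◁-reduced a (u ++ v) r ⟩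
  a ∷ u ++ v    ∎

length-◁-cancel : ∀ a w → w ≡ inv a ∷ (a ◁ w) → length (a ◁ w) < length w
length-◁-cancel a w e = subst (λ v → length (a ◁ w) < length v) (sym e) ≤-refl

·-view : ∀ u v → u · v ≡ u ++ v ⊎ length (u · v) < length (u ++ v)
·-view [] v = inj₁ refl
·-view (a ∷ u) v with ·-view u v | ◁-view a (u · v)
... | inj₁ e  | inj₁ e′ = inj₁ (trans e′ (cong (a ∷_) e))
... | inj₁ e  | inj₂ e′ =
  inj₂ (m<n⇒m<1+n (subst (λ w → length (a ◁ (u · v)) < length w) e (length-◁-cancel a (u · v) e′)))
... | inj₂ lt | inj₁ e′ = inj₂ (subst (λ w → length w < _) (sym e′) (s≤s lt))
... | inj₂ lt | inj₂ e′ = inj₂ (m<n⇒m<1+n (<-trans (length-◁-cancel a (u · v) e′) lt))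

++-prefix : ∀ {A : Set} (xs ys zs ws : List A) →
            xs ++ ys ≡ zs ++ ws → length xs ≤ length zs → Σ (List A) λ t → zs ≡ xs ++ t
++-prefix [] ys zs ws _ _ = zs , refl
++-prefix (x ∷ xs) ys (z ∷ zs) ws e (s≤s le) with ++-prefix xs ys zs ws (∷-injectiveʳ e) le
... | t , refl = t , cong (_∷ xs ++ t) (sym (∷-injectiveˡ e))

++-comm⇒suffix : ∀ {A : Set} (u v : List A) →
                 u ++ v ≡ v ++ u → length u ≤ length v → Σ (List A) λ t → v ≡ t ++ u
++-comm⇒suffix u v e le with ++-prefix u v v u e le
... | t , refl = t , ++-cancelˡ u (u ++ t) (t ++ u) (trans e (++-assoc u t u))

·-comm⇒++-comm : ∀ u v → Reduced (u ++ v) → u · v ≡ v · u → u ++ v ≡ v ++ u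
·-comm⇒++-comm u v r comm = begin
  u ++ v  ≡⟨ sym uv≡u++v ⟩
  u · v   ≡⟨ comm ⟩
  v · u   ≡⟨ vu≡v++u ⟩
  v ++ u  ∎
  where
  uv≡u++v : u · v ≡ u ++ v
  uv≡u++v = ·-++ u v r

  vu≡v++u : v · u ≡ v ++ u
  vu≡v++u with ·-view v u
  ... | inj₁ e = e
  ... | inj₂ lt = contradiction
    (trans (cong length (trans (sym comm) uv≡u++v)) (length-++-comm u v)) (<⇒≢ lt)

module ActionProperties {ℓ : Level} {Ω : Set ℓ} (A : Action Ω) where
  open Action A

  act-++ : ∀ u v z → Reduced (u ++ v) → act (u ++ v) z ≡ act u (act v z)
  act-++ u v z r = begin
    act (u ++ v) z   ≡⟨ cong (λ w → act w z) (sym (·-++ u v r)) ⟩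
    act (u · v) z    ≡⟨ act-mul u v (Reduced-++ˡ u v r) (Reduced-++ʳ u v r) z ⟩
    act u (act v z)  ∎

  act-◁-ε : ∀ a b z → a ◁ (b ∷ []) ≡ [] → act (a ∷ []) (act (b ∷ []) z) ≡ z
  act-◁-ε a b z ab≡ε = begin
    act (a ∷ []) (act (b ∷ []) z)  ≡⟨ sym (act-mul (a ∷ []) (b ∷ []) tt tt z) ⟩
    act (a ◁ (b ∷ [])) z           ≡⟨ cong (λ w → act w z) ab≡ε ⟩
    act [] z                       ≡⟨ act-ε z ⟩
    z                              ∎

  act-inverseˡ : ∀ a z → act (inv a ∷ []) (act (a ∷ []) z) ≡ z
  act-inverseˡ a z = act-◁-ε (inv a) a z (inv-◁-cancel a [])

  act-inverseʳ : ∀ a z → act (a ∷ []) (act (inv a ∷ []) z) ≡ z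
  act-inverseʳ a z = act-◁-ε a (inv a) z (◁-cancel a [])

module NormalForm {ℓ : Level} {Ω : Set ℓ} (A : Action Ω) (abelian : AbelianStabilisers A) (x : Ω)
  (α : Letter) (ω′ : Word) (ω-reduced : Reduced (α ∷ ω′))
  (ω-minimal : ∀ γ y → ¬ (γ ≡ ε) → InOrbit A x y → Fixes A γ y → length (α ∷ ω′) ≤ length γ)
  (ω-fixes : Action.act A (α ∷ ω′) x ≡ x) where

  open Action A
  open ActionProperties A

  ω : Word
  ω = α ∷ ω′

  π : Word → Ω
  π ζ = act ζ x

  record Normal (ζ : Word) : Set where
    constructor normal
    field
      reduced     : Reduced ζ
      ¬endsIn-α⁻¹ : ¬ EndsIn ζ (inv α ∷ [])
      ¬endsIn-ω   : ¬ EndsIn ζ ω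

  open Normal

  Normal-[] : Normal []
  Normal-[] = normal tt (¬EndsIn-[] _ _) (¬EndsIn-[] _ _)

  Normal-tail : ∀ c ξ → Normal (c ∷ ξ) → Normal ξ
  Normal-tail c ξ n = normal
    (Reduced-tail c ξ (reduced n))
    (¬endsIn-α⁻¹ n ∘ EndsIn-∷ c ξ _ (reduced n))
    (¬endsIn-ω n ∘ EndsIn-∷ c ξ _ (reduced n))

  Normal⇒≢ω : ∀ ζ → Normal ζ → ζ ≢ ω
  Normal⇒≢ω ζ n ζ≡ω = ¬endsIn-ω n ([] , ω-reduced , ζ≡ω)

  ω′-acts-as-α⁻¹ : π ω′ ≡ act (inv α ∷ []) x
  ω′-acts-as-α⁻¹ = begin
    act ω′ x                                   ≡⟨ sym (act-inverseˡ α _) ⟩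
    act (inv α ∷ []) (act (α ∷ []) (act ω′ x)) ≡⟨ cong (act (inv α ∷ [])) (sym (act-++ (α ∷ []) ω′ x ω-reduced)) ⟩
    act (inv α ∷ []) (act ω x)                 ≡⟨ cong (act (inv α ∷ [])) ω-fixes ⟩
    act (inv α ∷ []) x                         ∎

  ω-cyclically-reduced : ¬ EndsIn ω′ (inv α ∷ [])
  ω-cyclically-reduced ([] , _ , e) = proj₁ (subst (λ w → Reduced (α ∷ w)) e ω-reduced) refl
  ω-cyclically-reduced (s@(_ ∷ _) , r , e) =
    ≤⇒≯ (ω-minimal s z (λ ()) (inv α ∷ [] , tt , refl) (Reduced-++ˡ s _ r , s-fixes-z)) s-shorter
    where
    z = act (inv α ∷ []) x

    s-fixes-z : act s z ≡ z
    s-fixes-z = begin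
      act s z                       ≡⟨ sym (act-++ s (inv α ∷ []) x r) ⟩
      act (s ++ inv α ∷ []) x       ≡⟨ cong (λ w → act w x) (sym e) ⟩
      act ω′ x                      ≡⟨ ω′-acts-as-α⁻¹ ⟩
      z                             ∎

    s-shorter : length s < length ω
    s-shorter = s≤s (subst (λ w → length s ≤ length w) (sym e) (length-++-≤ˡ s))

  Normal-ω′ : Normal ω′
  Normal-ω′ = normal (Reduced-tail α ω′ ω-reduced) ω-cyclically-reduced
    (1+n≰n ∘ EndsIn-length ω′ ω)

  _∷ω_ : Letter → Word → Word
  b ∷ω ξ with ≡-dec _≟_ (b ∷ ξ) ω
  ... | yes _ = []
  ... | no _ = b ∷ ξ

  _⋆_ : Letter → Word → Word
  b ⋆ [] with b ≟ inv α
  ... | yes _ = ω′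
  ... | no _ = b ∷ω []
  b ⋆ (c ∷ ξ) with c ≟ inv b
  ... | yes _ = ξ
  ... | no _ = b ∷ω (c ∷ ξ)

  ∷ω-≡ω : ∀ b ξ → b ∷ ξ ≡ ω → b ∷ω ξ ≡ []
  ∷ω-≡ω b ξ b∷ξ≡ω with ≡-dec _≟_ (b ∷ ξ) ω
  ... | yes _ = refl
  ... | no b∷ξ≢ω = contradiction b∷ξ≡ω b∷ξ≢ω

  ∷ω-≢ω : ∀ b ξ → b ∷ ξ ≢ ω → b ∷ω ξ ≡ b ∷ ξ
  ∷ω-≢ω b ξ b∷ξ≢ω with ≡-dec _≟_ (b ∷ ξ) ω
  ... | yes b∷ξ≡ω = contradiction b∷ξ≡ω b∷ξ≢ω
  ... | no _ = refl

  π-∷ω : ∀ b ξ → Reduced (b ∷ ξ) → π (b ∷ω ξ) ≡ act (b ∷ []) (π ξ)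
  π-∷ω b ξ r with ≡-dec _≟_ (b ∷ ξ) ω
  ... | no _ = act-++ (b ∷ []) ξ x r
  ... | yes b∷ξ≡ω = begin
    act [] x               ≡⟨ act-ε x ⟩
    x                      ≡⟨ sym ω-fixes ⟩
    act ω x                ≡⟨ cong (λ w → act w x) (sym b∷ξ≡ω) ⟩
    act (b ∷ ξ) x          ≡⟨ act-++ (b ∷ []) ξ x r ⟩
    act (b ∷ []) (π ξ)     ∎

  π-⋆ : ∀ b ξ → Reduced ξ → π (b ⋆ ξ) ≡ act (b ∷ []) (π ξ)
  π-⋆ b [] _ with b ≟ inv α
  ... | yes refl = trans ω′-acts-as-α⁻¹ (cong (act (inv α ∷ [])) (sym (act-ε x)))
  ... | no _ = π-∷ω b [] tt
  π-⋆ b (c ∷ ξ) r with c ≟ inv b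
  ... | no c≢b⁻¹ = π-∷ω b (c ∷ ξ) (c≢b⁻¹ , r)
  ... | yes refl = sym (begin
    act (b ∷ []) (act (inv b ∷ ξ) x)          ≡⟨ cong (act (b ∷ [])) (act-++ (inv b ∷ []) ξ x r) ⟩
    act (b ∷ []) (act (inv b ∷ []) (π ξ))     ≡⟨ act-inverseʳ b (π ξ) ⟩
    π ξ                                       ∎)

  Normal-∷ω : ∀ b ξ → Normal ξ → Reduced (b ∷ ξ) → b ∷ ξ ≢ inv α ∷ [] → Normal (b ∷ω ξ)
  Normal-∷ω b ξ n r b∷ξ≢α⁻¹ with ≡-dec _≟_ (b ∷ ξ) ω
  ... | yes _ = Normal-[]
  ... | no b∷ξ≢ω = normal r
    (¬EndsIn-∷ b ξ _ b∷ξ≢α⁻¹ (¬endsIn-α⁻¹ n))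
    (¬EndsIn-∷ b ξ _ b∷ξ≢ω (¬endsIn-ω n))

  Normal-⋆ : ∀ b ξ → Normal ξ → Normal (b ⋆ ξ)
  Normal-⋆ b [] n with b ≟ inv α
  ... | yes _ = Normal-ω′
  ... | no b≢α⁻¹ = Normal-∷ω b [] n tt (b≢α⁻¹ ∘ ∷-injectiveˡ)
  Normal-⋆ b (c ∷ ξ) n with c ≟ inv b
  ... | yes _ = Normal-tail c ξ n
  ... | no c≢b⁻¹ = Normal-∷ω b (c ∷ ξ) n (c≢b⁻¹ , reduced n) λ ()

  ⋆-normal : ∀ a ζ → Normal (a ∷ ζ) → a ⋆ ζ ≡ a ∷ ζ
  ⋆-normal a [] n with a ≟ inv α
  ... | yes refl = ⊥-elim (¬endsIn-α⁻¹ n ([] , tt , refl))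
  ... | no _ = ∷ω-≢ω a [] (Normal⇒≢ω _ n)
  ⋆-normal a (c ∷ ζ) n with c ≟ inv a
  ... | yes refl = ⊥-elim (proj₁ (reduced n) refl)
  ... | no _ = ∷ω-≢ω a (c ∷ ζ) (Normal⇒≢ω _ n)

  ⋆-ω : ∀ b ξ → b ∷ ξ ≡ ω → b ⋆ ξ ≡ []
  ⋆-ω b [] b∷ξ≡ω with b ≟ inv α
  ... | yes b≡α⁻¹ = ⊥-elim (a≢inv-a α (trans (sym (∷-injectiveˡ b∷ξ≡ω)) b≡α⁻¹))
  ... | no _ = ∷ω-≡ω b [] b∷ξ≡ω
  ⋆-ω b (c ∷ ξ) b∷ξ≡ω with c ≟ inv b
  ... | yes refl = ⊥-elim (proj₁ (subst Reduced (sym b∷ξ≡ω) ω-reduced) refl)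
  ... | no _ = ∷ω-≡ω b (c ∷ ξ) b∷ξ≡ω

  inv-⋆-cancel : ∀ a ξ → inv a ⋆ (a ∷ ξ) ≡ ξ
  inv-⋆-cancel a ξ with a ≟ inv (inv a)
  ... | yes _ = refl
  ... | no a≢a = contradiction (sym (inv-involutive a)) a≢a

  inv-⋆-ε : ∀ a ξ → a ∷ ξ ≡ ω → inv a ⋆ [] ≡ ξ
  inv-⋆-ε a ξ a∷ξ≡ω with inv a ≟ inv α
  ... | yes _ = sym (∷-injectiveʳ a∷ξ≡ω)
  ... | no a⁻¹≢α⁻¹ = contradiction (cong inv (∷-injectiveˡ a∷ξ≡ω)) a⁻¹≢α⁻¹

  ⋆-inverseˡ : ∀ a ξ → Normal ξ → inv a ⋆ (a ⋆ ξ) ≡ ξ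
  ⋆-inverseˡ a [] _ with a ≟ inv α
  ... | yes refl = ⋆-ω (inv (inv α)) ω′ (cong (_∷ ω′) (inv-involutive α))
  ... | no _ with ≡-dec _≟_ (a ∷ []) ω
  ...   | yes a≡ω = inv-⋆-ε a [] a≡ω
  ...   | no _ = inv-⋆-cancel a []
  ⋆-inverseˡ a (c ∷ ξ) n with c ≟ inv a
  ... | yes refl = ⋆-normal (inv a) ξ n
  ... | no _ with ≡-dec _≟_ (a ∷ c ∷ ξ) ω
  ...   | yes a∷c∷ξ≡ω = inv-⋆-ε a (c ∷ ξ) a∷c∷ξ≡ω
  ...   | no _ = inv-⋆-cancel a (c ∷ ξ)

  ⋆-inverseʳ : ∀ a ξ → Normal ξ → a ⋆ (inv a ⋆ ξ) ≡ ξ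
  ⋆-inverseʳ a ξ n = subst (λ b → b ⋆ (inv a ⋆ ξ) ≡ ξ) (inv-involutive a) (⋆-inverseˡ (inv a) ξ n)

  Normal-fixing-x⇒ε : ∀ ζ → Normal ζ → π ζ ≡ x → ζ ≡ []
  Normal-fixing-x⇒ε [] _ _ = refl
  Normal-fixing-x⇒ε ζ@(_ ∷ _) n ζx≡x with ++-comm⇒suffix ω ζ (sym ζω≡ωζ) ω≤ζ
    where
    ζω≡ωζ : ζ ++ ω ≡ ω ++ ζ
    ζω≡ωζ = ·-comm⇒++-comm ζ ω (Reduced-++ ζ α ω′ (reduced n) ω-reduced (¬endsIn-α⁻¹ n))
      (abelian x ζ ω (reduced n , ζx≡x) (ω-reduced , ω-fixes))

    ω≤ζ : length ω ≤ length ζ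
    ω≤ζ = ω-minimal ζ x (λ ()) ([] , tt , act-ε x) (reduced n , ζx≡x)
  ... | t , ζ≡tω = ⊥-elim (¬endsIn-ω n (t , subst Reduced ζ≡tω (reduced n) , ζ≡tω))

  normal-form-exists : ∀ γ → Reduced γ → Σ Word λ ζ → Normal ζ × π ζ ≡ π γ
  normal-form-exists [] _ = [] , Normal-[] , refl
  normal-form-exists (a ∷ γ) r with normal-form-exists γ (Reduced-tail a γ r)
  ... | ζ , n , ζx≡γx = a ⋆ ζ , Normal-⋆ a ζ n , (begin
    π (a ⋆ ζ)            ≡⟨ π-⋆ a ζ (reduced n) ⟩
    act (a ∷ []) (π ζ)   ≡⟨ cong (act (a ∷ [])) ζx≡γx ⟩
    act (a ∷ []) (π γ)   ≡⟨ sym (act-++ (a ∷ []) γ x r) ⟩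
    π (a ∷ γ)            ∎)

  normal-form-unique : ∀ ζ ξ → Normal ζ → Normal ξ → π ζ ≡ π ξ → ζ ≡ ξ
  normal-form-unique [] ξ _ nξ x≡ξx = sym (Normal-fixing-x⇒ε ξ nξ (trans (sym x≡ξx) (act-ε x)))
  normal-form-unique (a ∷ ζ) ξ nζ nξ aζx≡ξx = begin
    a ∷ ζ              ≡⟨ sym (⋆-normal a ζ nζ) ⟩
    a ⋆ ζ              ≡⟨ cong (a ⋆_) (normal-form-unique ζ (inv a ⋆ ξ) (Normal-tail a ζ nζ) (Normal-⋆ (inv a) ξ nξ) peeled) ⟩
    a ⋆ (inv a ⋆ ξ)    ≡⟨ ⋆-inverseʳ a ξ nξ ⟩
    ξ                  ∎
    where
    peeled : π ζ ≡ π (inv a ⋆ ξ)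
    peeled = begin
      π ζ                                   ≡⟨ sym (act-inverseˡ a (π ζ)) ⟩
      act (inv a ∷ []) (act (a ∷ []) (π ζ)) ≡⟨ cong (act (inv a ∷ [])) (sym (act-++ (a ∷ []) ζ x (reduced nζ))) ⟩
      act (inv a ∷ []) (π (a ∷ ζ))          ≡⟨ cong (act (inv a ∷ [])) aζx≡ξx ⟩
      act (inv a ∷ []) (π ξ)                ≡⟨ sym (π-⋆ (inv a) ξ (reduced nξ)) ⟩
      π (inv a ⋆ ξ)                         ∎

  unique-normal-form : ∀ y → InOrbit A x y →
    Σ Word λ ζ → (Normal ζ × π ζ ≡ y) × (∀ ζ₁ → Normal ζ₁ → π ζ₁ ≡ y → ζ₁ ≡ ζ)
  unique-normal-form y (γ , γ-reduced , γx≡y) with normal-form-exists γ γ-reduced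
  ... | ζ , n , ζx≡γx = ζ , (n , trans ζx≡γx γx≡y) ,
    λ ζ₁ n₁ ζ₁x≡y → normal-form-unique ζ₁ ζ n₁ n (trans ζ₁x≡y (sym (trans ζx≡γx γx≡y)))

-- The hypothesis that every point of the orbit has a nontrivial stabiliser only
-- guarantees that ω exists.
lemma4p5 : {ℓ : Level} {Ω : Set ℓ} (A : Action Ω) →
    AbelianStabilisers A →
    (x : Ω) →
    (∀ y → InOrbit A x y → Σ Word λ γ → ¬ (γ ≡ ε) × Fixes A γ y) →
    (ω : Word) → Reduced ω → ¬ (ω ≡ ε) →
    (∀ γ y → ¬ (γ ≡ ε) → InOrbit A x y → Fixes A γ y → length ω ≤ length γ) →
    Action.act A ω x ≡ x →
    (α : Letter) → (ω' : Word) → ω ≡ α ∷ ω' →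
    ∀ y → InOrbit A x y →
    Σ Word λ ζ →
      (Reduced ζ × ¬ EndsIn ζ (inv α ∷ []) × ¬ EndsIn ζ ω × Action.act A ζ x ≡ y)
      × (∀ ζ₁ → Reduced ζ₁ → ¬ EndsIn ζ₁ (inv α ∷ []) → ¬ EndsIn ζ₁ ω →
           Action.act A ζ₁ x ≡ y → ζ₁ ≡ ζ)
lemma4p5 A abelian x _ .(α ∷ ω′) ω-reduced _ ω-minimal ω-fixes α ω′ refl y y∈orbit =
  let ζ , (n , ζx≡y) , unique = unique-normal-form y y∈orbit in
  ζ , (reduced n , ¬endsIn-α⁻¹ n , ¬endsIn-ω n , ζx≡y) ,
  λ ζ₁ r ¬α⁻¹ ¬ω → unique ζ₁ (normal r ¬α⁻¹ ¬ω)
  where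
  open NormalForm A abelian x α ω′ ω-reduced ω-minimal ω-fixes
  open Normal
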